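{- Let $(t_n)_{n\ge 0}$ be a subprime Fibonacci sequence with $\gcd(t_0,t_1)=1$. Then the sequence is non-trivial, i.e., it is not eventually constant.
   Context: A subprime Fibonacci sequence is a sequence $(t_n)_{n\ge0}$ of positive integers in which $t_0,t_1$ are arbitrary positive integers and, for every $n\ge0$, with $s=t_n+t_{n+1}$: $t_{n+2}=s$ if $s$ is prime, and $t_{n+2}=s/p$ if $s$ is composite, where $p$ is the smallest prime factor of $s$. Such a sequence is called trivial if it is eventually constant, and non-trivial otherwise. -}

module Defs where

open import Data.Nat using (ℕ; suc; _+_; _*_; _≤_; _<_)
open import Data.Nat.Divisibility using (_∣_)
open import Data.Nat.Primality using (Prime)
open import Data.Nat.GCD using (gcd)
open import Data.Product using (Σ; _×_; ∃-syntax)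
open import Relation.Nullary using (¬_)
open import Relation.Binary.PropositionalEquality using (_≡_)

SmallestPrimeFactor : ℕ → ℕ → Set
SmallestPrimeFactor p s = Prime p × p ∣ s × (∀ q → Prime q → q ∣ s → p ≤ q)

-- the subprime Fibonacci step: u is the successor term determined by s = t_n + t_{n+1}
-- (s ≥ 2 always since terms are positive, so "not prime" means composite)
SubprimeStep : ℕ → ℕ → Set
SubprimeStep s u = (Prime s → u ≡ s) × (¬ Prime s → ∃[ p ] (SmallestPrimeFactor p s × u * p ≡ s))

IsSubprimeFib : (ℕ → ℕ) → Set
IsSubprimeFib t = (∀ n → 0 < t n) × (∀ n → SubprimeStep (t n + t (suc n)) (t (suc (suc n))))

EventuallyConstant : (ℕ → ℕ) → Set
EventuallyConstant t = ∃[ N ] (∀ n → N ≤ n → t n ≡ t N)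

Trivial : (ℕ → ℕ) → Set
Trivial = EventuallyConstant

{-# OPTIONS --safe #-}
module Submission where

-- Every term divides the sum of the two terms before it, so a common divisor of two
-- consecutive terms also divides the preceding one; coprimality of t₀, t₁ therefore
-- propagates to all consecutive pairs. A constant tail c would make c coprime to
-- itself, i.e. c = 1, but the successor of 1, 1 is the prime 1 + 1 = 2.

open import Defs
open import Data.Nat using (ℕ; zero; suc; _+_)
open import Data.Nat.Properties using (+-comm; n≤1+n; m≤n⇒m≤1+n)
open import Data.Nat.Divisibility using (_∣_; ∣-refl; ∣-reflexive; ∣-trans; m∣m*n; ∣m+n∣m⇒∣n)
open import Data.Nat.GCD using (gcd)
open import Data.Nat.Coprimality using (Coprime; gcd≡1⇒coprime)
open import Data.Nat.Primality using (Prime; prime?; prime[2])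
open import Data.Product using (_,_; proj₁)
open import Relation.Nullary using (¬_; yes; no; contradiction)
open import Relation.Binary.PropositionalEquality using (_≡_; sym; trans; cong₂; subst)

SubprimeStep⇒∣ : ∀ {s u} → SubprimeStep s u → u ∣ s
SubprimeStep⇒∣ {s} {u} (prime-case , composite-case) with prime? s
... | yes s-prime = ∣-reflexive (prime-case s-prime)
... | no s-composite with composite-case s-composite
...   | p , _ , u*p≡s = subst (u ∣_) u*p≡s (m∣m*n p)

coprime-∣+ : ∀ {a b c} → c ∣ a + b → Coprime a b → Coprime b c
coprime-∣+ {a} {b} c∣a+b a⊥b {d} (d∣b , d∣c) = a⊥b (d∣a , d∣b)
  where
    d∣b+a : d ∣ b + a
    d∣b+a = subst (d ∣_) (+-comm a b) (∣-trans d∣c c∣a+b)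

    d∣a : d ∣ a
    d∣a = ∣m+n∣m⇒∣n d∣b+a d∣b

coprime-consecutive : (t : ℕ → ℕ) → (∀ n → t (suc (suc n)) ∣ t n + t (suc n)) →
                      Coprime (t 0) (t 1) → ∀ n → Coprime (t n) (t (suc n))
coprime-consecutive t step t₀⊥t₁ zero    = t₀⊥t₁
coprime-consecutive t step t₀⊥t₁ (suc n) = coprime-∣+ (step n) (coprime-consecutive t step t₀⊥t₁ n)

corollary3 : (t : ℕ → ℕ) → IsSubprimeFib t → gcd (t 0) (t 1) ≡ 1 → ¬ Trivial t
corollary3 t (_ , step) gcd≡1 (N , constant) =
  contradiction (trans (sym t[N+2]≡2) (trans t[N+2]≡t[N] t[N]≡1)) λ ()
  where
    t[N+1]≡t[N] : t (suc N) ≡ t N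
    t[N+1]≡t[N] = constant (suc N) (n≤1+n N)

    t[N+2]≡t[N] : t (suc (suc N)) ≡ t N
    t[N+2]≡t[N] = constant (suc (suc N)) (m≤n⇒m≤1+n (n≤1+n N))

    t[N]≡1 : t N ≡ 1
    t[N]≡1 = coprime-consecutive t (λ n → SubprimeStep⇒∣ (step n)) (gcd≡1⇒coprime gcd≡1) N
               (∣-refl , ∣-reflexive (sym t[N+1]≡t[N]))

    sum≡2 : t N + t (suc N) ≡ 2
    sum≡2 = cong₂ _+_ t[N]≡1 (trans t[N+1]≡t[N] t[N]≡1)

    t[N+2]≡2 : t (suc (suc N)) ≡ 2
    t[N+2]≡2 = trans (proj₁ (step N) (subst Prime (sym sum≡2) prime[2])) sum≡2
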